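{- Let $n=p_1^{a_1}p_2^{a_2}\cdots p_r^{a_r}$ with $p_1,\dots,p_r$ distinct primes and $a_i\ge 1$. Identify each divisor $d=\prod_{i=1}^r p_i^{b_i}$ ($0\le b_i\le a_i$) of $n$ with its exponent vector $(b_1,\dots,b_r)$, and order the divisors lexicographically by exponent vector; for each $i$ order the divisors of $p_i^{a_i}$ as $1,p_i,\dots,p_i^{a_i}$. Let $A(m)$ denote the adjacency matrix of the modified divisor prime graph $G^*_{Dp}(m)$ with respect to these orderings. Then \[ A(n)=A(p_1^{a_1})\otimes A(p_2^{a_2})\otimes\cdots\otimes A(p_r^{a_r}), \] where $\otimes$ is the Kronecker product.
   Context: For a positive integer $m$, the modified divisor prime graph $G^*_{Dp}(m)$ has vertex set the set of positive divisors of $m$, and two (not necessarily distinct) vertices $u,v$ are adjacent iff $\gcd(u,v)=1$; in particular the only self-loop is at vertex $1$. The adjacency matrix has entry $1$ in position $(u,v)$ iff $\gcd(u,v)=1$ (so the diagonal entry at vertex $1$ is $1$) and $0$ otherwise. The Kronecker product of $A=(a_{ij})\in\mathbb{R}^{m\times n}$ and $B$ is the block matrix $(a_{ij}B)$. -}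

module Defs where

open import Data.Nat using (ℕ; zero; suc; _*_; _^_)
open import Data.Nat.GCD using (gcd)
open import Data.Fin using (Fin; zero; suc; toℕ; remQuot)
open import Data.Product using (_,_; proj₁; proj₂)
open import Relation.Nullary.Decidable using (does)
open import Data.Bool using (if_then_else_)
import Data.Nat as ℕ

Mat : ℕ → ℕ → Set
Mat m n = Fin m → Fin n → ℕ

-- Kronecker product: row index of (A ⊗ B) is combine i k = i * m' + k,
-- decoded by remQuot (the standard block-matrix layout (a_ij B)).
_⊗_ : ∀ {m n m' n'} → Mat m n → Mat m' n' → Mat (m * m') (n * n')
_⊗_ {m} {n} {m'} {n'} A B i j =
  A (proj₁ (remQuot {m} m' i)) (proj₁ (remQuot {n} n' j))
    * B (proj₂ (remQuot {m} m' i)) (proj₂ (remQuot {n} n' j))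

dimProd : (r : ℕ) → (Fin r → ℕ) → ℕ
dimProd zero s = 1
dimProd (suc r) s = s zero * dimProd r (λ i → s (suc i))

kronAll : (r : ℕ) (s : Fin r → ℕ) → ((i : Fin r) → Mat (s i) (s i))
        → Mat (dimProd r s) (dimProd r s)
kronAll zero s A _ _ = 1
kronAll (suc r) s A = A zero ⊗ kronAll r (λ i → s (suc i)) (λ i → A (suc i))

-- Adjacency matrix of the modified divisor prime graph w.r.t. an ordering
-- d of the vertex set (d k is the k-th divisor): entry 1 iff gcd = 1.
adjMat : ∀ {k} → (Fin k → ℕ) → Mat k k
adjMat d i j = if does (gcd (d i) (d j) ℕ.≟ 1) then 1 else 0

numDiv : (r : ℕ) → (Fin r → ℕ) → ℕ
numDiv r a = dimProd r (λ i → suc (a i))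

-- The k-th exponent vector (b_1,...,b_r), 0 ≤ b_i ≤ a_i, in lexicographic
-- order (mixed radix, first coordinate most significant).
expVec : (r : ℕ) (a : Fin r → ℕ) → Fin (numDiv r a) → Fin r → ℕ
expVec zero a k ()
expVec (suc r) a k zero = toℕ (proj₁ (remQuot {suc (a zero)} (numDiv r (λ i → a (suc i))) k))
expVec (suc r) a k (suc i) =
  expVec r (λ i → a (suc i)) (proj₂ (remQuot {suc (a zero)} (numDiv r (λ i → a (suc i))) k)) i

prodPow : (r : ℕ) → (Fin r → ℕ) → (Fin r → ℕ) → ℕ
prodPow zero p b = 1
prodPow (suc r) p b = p zero ^ b zero * prodPow r (λ i → p (suc i)) (λ i → b (suc i))

lexDivisors : (r : ℕ) (p a : Fin r → ℕ) → Fin (numDiv r a) → ℕ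
lexDivisors r p a k = prodPow r p (expVec r a k)

powDivisors : (p a : ℕ) → Fin (suc a) → ℕ
powDivisors p a j = p ^ toℕ j

-- A divisor of p₁^a₁ ⋯ p_r^a_r at lexicographic position k splits as p₁^b · m, where
-- the block index of k in the Kronecker layout gives b and the offset gives the
-- divisor m of p₂^a₂ ⋯ p_r^a_r. Since p₁ is coprime to every other pᵢ, the cross terms
-- p₁^b ⊥ m' and m ⊥ p₁^b' hold automatically, and then p₁^b·m ⊥ p₁^b'·m' iff
-- p₁^b ⊥ p₁^b' and m ⊥ m'. So each entry of A(n) is the product of an entry of
-- A(p₁^a₁) and an entry of A(p₂^a₂ ⋯ p_r^a_r); induction on r finishes.
module Submission where

open import Defs
open import Data.Nat using (ℕ; suc; _≤_)
open import Data.Nat.Primality using (Prime)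
open import Data.Fin using (Fin)
open import Function.Definitions using (Injective)
open import Relation.Binary.PropositionalEquality using (_≡_)

open import Data.Bool using (Bool; true; false; if_then_else_; _∧_)
open import Data.Empty using (⊥-elim)
open import Data.Fin using (zero; suc; toℕ; remQuot)
open import Data.Fin.Properties using (suc-injective; 0≢1+n)
open import Data.Nat using (zero; _*_; _^_)
open import Data.Nat.Coprimality as Coprime
  using (Coprime; coprime?; coprime-divisor)
open import Data.Nat.Divisibility using (_∣_; ∣-trans; ∣1⇒≡1; m∣m*n; n∣m*n)
open import Data.Nat.Primality using (prime⇒irreducible; ¬prime[1])
open import Data.Nat.Properties using (+-identityʳ)
open import Data.Product using (_×_; _,_; proj₁; proj₂)
open import Data.Sum using (inj₁; inj₂)
open import Function.Bundles using (_⇔_; mk⇔)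
open import Relation.Binary.PropositionalEquality using (refl; sym; trans; cong; subst; module ≡-Reasoning)
open import Relation.Nullary using (¬_; does; _×-dec_)
open import Relation.Nullary.Decidable using (does-⇔)

coprime-1ˡ : ∀ m → Coprime 1 m
coprime-1ˡ m (i∣1 , _) = ∣1⇒≡1 i∣1

coprime-∣ʳ : ∀ {a b c} → Coprime a c → b ∣ c → Coprime a b
coprime-∣ʳ a⊥c b∣c (i∣a , i∣b) = a⊥c (i∣a , ∣-trans i∣b b∣c)

coprime-*ˡ : ∀ {a b c} → Coprime a c → Coprime b c → Coprime (a * b) c
coprime-*ˡ a⊥c b⊥c (i∣ab , i∣c) =
  b⊥c (coprime-divisor (Coprime.sym (coprime-∣ʳ a⊥c i∣c)) i∣ab , i∣c)

coprime-*ʳ : ∀ {a b c} → Coprime a b → Coprime a c → Coprime a (b * c)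
coprime-*ʳ a⊥b a⊥c = Coprime.sym (coprime-*ˡ (Coprime.sym a⊥b) (Coprime.sym a⊥c))

coprime-^ˡ : ∀ {a m} e → Coprime a m → Coprime (a ^ e) m
coprime-^ˡ {m = m} zero    _   = coprime-1ˡ m
coprime-^ˡ         (suc e) a⊥m = coprime-*ˡ a⊥m (coprime-^ˡ e a⊥m)

coprime-prodPow : ∀ {x} r (q e : Fin r → ℕ) →
                  (∀ i → Coprime x (q i)) → Coprime x (prodPow r q e)
coprime-prodPow {x} zero    q e x⊥q = Coprime.sym (coprime-1ˡ x)
coprime-prodPow     (suc r) q e x⊥q =
  coprime-*ʳ (Coprime.sym (coprime-^ˡ (e zero) (Coprime.sym (x⊥q zero))))
             (coprime-prodPow r (λ i → q (suc i)) (λ i → e (suc i)) (λ i → x⊥q (suc i)))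

prime≢⇒coprime : ∀ {p q} → Prime p → Prime q → ¬ p ≡ q → Coprime p q
prime≢⇒coprime pp pq p≢q {i} (i∣p , i∣q) with prime⇒irreducible pp i∣p
... | inj₁ i≡1 = i≡1
... | inj₂ refl with prime⇒irreducible pq i∣q
...   | inj₁ p≡1 = ⊥-elim (¬prime[1] (subst Prime p≡1 pp))
...   | inj₂ p≡q = ⊥-elim (p≢q p≡q)

coprime-*-⇔ : ∀ {x m y n} → Coprime x n → Coprime m y →
              Coprime (x * m) (y * n) ⇔ (Coprime x y × Coprime m n)
coprime-*-⇔ {x} {m} {y} {n} x⊥n m⊥y = mk⇔ split join
  where
  split : Coprime (x * m) (y * n) → Coprime x y × Coprime m n
  split xm⊥yn =
    (λ (i∣x , i∣y) → xm⊥yn (∣-trans i∣x (m∣m*n m) , ∣-trans i∣y (m∣m*n n))) ,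
    (λ (i∣m , i∣n) → xm⊥yn (∣-trans i∣m (n∣m*n x) , ∣-trans i∣n (n∣m*n y)))
  join : Coprime x y × Coprime m n → Coprime (x * m) (y * n)
  join (x⊥y , m⊥n) = coprime-*ˡ (coprime-*ʳ x⊥y x⊥n) (coprime-*ʳ m⊥y m⊥n)

indicator : Bool → ℕ
indicator b = if b then 1 else 0

indicator-∧ : ∀ b c → indicator (b ∧ c) ≡ indicator b * indicator c
indicator-∧ true  c = sym (+-identityʳ (indicator c))
indicator-∧ false c = refl

-- Definitionally the entry of adjMat at two vertices u, v.
coprimality : ℕ → ℕ → ℕ
coprimality u v = indicator (does (coprime? u v))

coprimality-* : ∀ {x m y n} → Coprime x n → Coprime m y →
                coprimality (x * m) (y * n) ≡ coprimality x y * coprimality m n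
coprimality-* {x} {m} {y} {n} x⊥n m⊥y = trans
  (cong indicator (does-⇔ (coprime-*-⇔ x⊥n m⊥y)
                          (coprime? (x * m) (y * n)) (coprime? x y ×-dec coprime? m n)))
  (indicator-∧ (does (coprime? x y)) (does (coprime? m n)))

lexDivisors-adjMat-kronAll : ∀ r (p a : Fin r → ℕ) → (∀ i → Prime (p i)) → Injective _≡_ _≡_ p →
  ∀ (k l : Fin (numDiv r a)) →
  adjMat (lexDivisors r p a) k l
    ≡ kronAll r (λ i → suc (a i)) (λ i → adjMat (powDivisors (p i) (a i))) k l
lexDivisors-adjMat-kronAll zero    p a prime injective zero zero = refl
lexDivisors-adjMat-kronAll (suc r) p a prime injective k l = begin
  coprimality (p₀ ^ toℕ k₀ * divisor k′) (p₀ ^ toℕ l₀ * divisor l′)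
    ≡⟨ coprimality-* (p₀^-⊥-divisor k₀ l′) (Coprime.sym (p₀^-⊥-divisor l₀ k′)) ⟩
  coprimality (p₀ ^ toℕ k₀) (p₀ ^ toℕ l₀) * coprimality (divisor k′) (divisor l′)
    ≡⟨ cong (coprimality (p₀ ^ toℕ k₀) (p₀ ^ toℕ l₀) *_)
            (lexDivisors-adjMat-kronAll r p′ a′ (λ i → prime (suc i))
                                         (λ eq → suc-injective (injective eq)) k′ l′) ⟩
  coprimality (p₀ ^ toℕ k₀) (p₀ ^ toℕ l₀)
    * kronAll r (λ i → suc (a′ i)) (λ i → adjMat (powDivisors (p′ i) (a′ i))) k′ l′ ∎
  where
  open ≡-Reasoning
  p₀ = p zero
  p′ a′ : Fin r → ℕ
  p′ i = p (suc i)
  a′ i = a (suc i)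
  divisor : Fin (numDiv r a′) → ℕ
  divisor = lexDivisors r p′ a′
  k₀ = proj₁ (remQuot (numDiv r a′) k)
  k′ = proj₂ (remQuot (numDiv r a′) k)
  l₀ = proj₁ (remQuot (numDiv r a′) l)
  l′ = proj₂ (remQuot (numDiv r a′) l)
  p₀^-⊥-divisor : ∀ (j : Fin (suc (a zero))) k → Coprime (p₀ ^ toℕ j) (divisor k)
  p₀^-⊥-divisor j k = coprime-^ˡ (toℕ j) (coprime-prodPow r p′ _ λ i →
    prime≢⇒coprime (prime zero) (prime (suc i)) (λ eq → 0≢1+n (injective eq)))

mainTheorem2 : (r : ℕ) → 1 ≤ r → (p a : Fin r → ℕ)
    → (∀ i → Prime (p i)) → Injective _≡_ _≡_ p → (∀ i → 1 ≤ a i)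
    → (n : ℕ) → n ≡ prodPow r p a
    → ∀ (k l : Fin (numDiv r a))
    → adjMat (lexDivisors r p a) k l
    ≡ kronAll r (λ i → suc (a i)) (λ i → adjMat (powDivisors (p i) (a i))) k l
mainTheorem2 r _ p a prime injective _ _ _ = lexDivisors-adjMat-kronAll r p a prime injective
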